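{- Let $J\ge5$ be an integer and let $n$ be an integer with $n\not\equiv0\pmod{2^{J-1}}$. Then $n=a+b$ for some integers $a,b$ with $a\equiv2^i\pmod{2^{i+2}}$ and $b\equiv2^j\pmod{2^{j+2}}$ for some integers $0\le i,j\le J-3$. -}

module Defs where

open import Data.Nat using (ℕ)
open import Data.Integer using (ℤ; _-_; _^_)
open import Data.Integer.Divisibility using (_∣_)

_≡_[mod_] : ℤ → ℤ → ℤ → Set
a ≡ b [mod m ] = m ∣ (a - b)

two^ : ℕ → ℤ
two^ k = ℤ.pos 2 ^ k

-- Call a an element of class i when a ≡ 2^i (mod 2^(i+2)), i.e. a is 2^i times a
-- number ≡ 1 (mod 4). Doubling moves classes up by one, so it suffices to treat n = 2m
-- with m odd, where 2m = 1 + (2m - 1) is a sum of two class-0 elements, and odd n,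
-- where n = (n - 4) + 4 or n = (n - 2) + 2 according to n mod 4.
module Submission where

open import Defs
open import Data.Nat using (ℕ; zero; suc; _≤_; _∸_; _+_; z≤n; s≤s)
open import Data.Nat.Properties using (≤-trans)
open import Data.Integer using (ℤ; +_; _*_; _-_) renaming (_+_ to _+ℤ_)
open import Data.Integer.Properties using (*-comm; *-distribˡ-+; +-identityˡ; +-identityʳ)
open import Data.Integer.DivMod using (_%_; _/_; n%d<d; a≡a%n+[a/n]*n)
import Data.Integer.Divisibility as Unsigned
open import Data.Integer.Divisibility.Signed using (_∣_; divides; ∣⇒∣ᵤ; *-monoʳ-∣)
open import Data.Integer.Tactic.RingSolver using (solve-∀)
open import Data.Product using (Σ; ∃; _×_; _,_)
open import Data.Sum using (_⊎_; inj₁; inj₂)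
open import Data.Empty using (⊥-elim)
open import Function using (_∘_)
open import Relation.Nullary using (¬_)
open import Relation.Binary.PropositionalEquality using (_≡_; refl; sym; trans; cong; subst)

even-or-odd : (x : ℤ) → ∃ λ q → x ≡ + 2 * q ⊎ x ≡ + 1 +ℤ + 2 * q
even-or-odd x with x % + 2 | n%d<d x (+ 2) | a≡a%n+[a/n]*n x (+ 2)
... | 0 | _ | x≡r+q*2 = x / + 2 , inj₁ (trans x≡r+q*2 (trans (+-identityˡ _) (*-comm (x / + 2) (+ 2))))
... | 1 | _ | x≡r+q*2 = x / + 2 , inj₂ (trans x≡r+q*2 (cong (+ 1 +ℤ_) (*-comm (x / + 2) (+ 2))))
... | suc (suc _) | s≤s (s≤s ()) | _

Class : ℕ → ℤ → Set
Class i a = ∃ λ q → a ≡ two^ i +ℤ q * two^ (i + 2)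

Class⇒≡[mod] : ∀ i {a} → Class i a → a ≡ two^ i [mod two^ (i + 2) ]
Class⇒≡[mod] i (q , a≡) = ∣⇒∣ᵤ (divides q (trans (cong (_- two^ i) a≡) (add-sub (two^ i) _)))
  where
  add-sub : ∀ p m → (p +ℤ m) - p ≡ m
  add-sub = solve-∀

two^-Class : ∀ i → Class i (two^ i)
two^-Class i = + 0 , sym (+-identityʳ (two^ i))

Class-double : ∀ i {a} → Class i a → Class (suc i) (+ 2 * a)
Class-double i (q , a≡) = q , trans (cong (+ 2 *_) a≡) (double (two^ i) (two^ (i + 2)) q)
  where
  double : ∀ p d q → + 2 * (p +ℤ q * d) ≡ + 2 * p +ℤ q * (+ 2 * d)
  double = solve-∀

SumOfClasses : ℕ → ℤ → Set
SumOfClasses t n = Σ ℤ λ a → Σ ℤ λ b → Σ ℕ λ i → Σ ℕ λ j →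
  (n ≡ a +ℤ b) × (i ≤ t) × (j ≤ t) × Class i a × Class j b

SumOfClasses-double : ∀ {t n} → SumOfClasses t n → SumOfClasses (suc t) (+ 2 * n)
SumOfClasses-double (a , b , i , j , n≡a+b , i≤t , j≤t , a∈i , b∈j) =
  + 2 * a , + 2 * b , suc i , suc j , trans (cong (+ 2 *_) n≡a+b) (*-distribˡ-+ (+ 2) a b) ,
  s≤s i≤t , s≤s j≤t , Class-double i a∈i , Class-double j b∈j

double-SumOfClasses : ∀ t m → ¬ two^ (suc t) ∣ m → SumOfClasses t (+ 2 * m)
double-SumOfClasses t m 2^[1+t]∤m with even-or-odd m
... | q , inj₂ refl =
  + 1 , + 1 +ℤ q * + 4 , 0 , 0 , 2[1+2q]≡1+[1+4q] q , z≤n , z≤n , two^-Class 0 , (q , refl)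
  where
  2[1+2q]≡1+[1+4q] : ∀ q → + 2 * (+ 1 +ℤ + 2 * q) ≡ + 1 +ℤ (+ 1 +ℤ q * + 4)
  2[1+2q]≡1+[1+4q] = solve-∀
... | q , inj₁ refl with t
...   | zero  = ⊥-elim (2^[1+t]∤m (divides q (*-comm (+ 2) q)))
...   | suc t = SumOfClasses-double (double-SumOfClasses t q (2^[1+t]∤m ∘ *-monoʳ-∣ (+ 2)))

odd-SumOfClasses : ∀ t → 2 ≤ t → ∀ q → SumOfClasses t (+ 1 +ℤ + 2 * q)
odd-SumOfClasses t 2≤t q with even-or-odd q
... | r , inj₁ refl =
  + 1 +ℤ (r - + 1) * + 4 , two^ 2 , 0 , 2 , 1+4r≡[1+4[r-1]]+4 r , z≤n , 2≤t ,
  (r - + 1 , refl) , two^-Class 2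
  where
  1+4r≡[1+4[r-1]]+4 : ∀ r → + 1 +ℤ + 2 * (+ 2 * r) ≡ (+ 1 +ℤ (r - + 1) * + 4) +ℤ + 4
  1+4r≡[1+4[r-1]]+4 = solve-∀
... | r , inj₂ refl =
  + 1 +ℤ r * + 4 , two^ 1 , 0 , 1 , 3+4r≡[1+4r]+2 r , z≤n , ≤-trans (s≤s z≤n) 2≤t ,
  (r , refl) , two^-Class 1
  where
  3+4r≡[1+4r]+2 : ∀ r → + 1 +ℤ + 2 * (+ 1 +ℤ + 2 * r) ≡ (+ 1 +ℤ r * + 4) +ℤ + 2
  3+4r≡[1+4r]+2 = solve-∀

SumOfClasses-of-∤ : ∀ t → 2 ≤ t → ∀ n → ¬ two^ (2 + t) ∣ n → SumOfClasses t n
SumOfClasses-of-∤ t 2≤t n 2^[2+t]∤n with even-or-odd n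
... | m , inj₁ refl = double-SumOfClasses t m (2^[2+t]∤n ∘ *-monoʳ-∣ (+ 2))
... | q , inj₂ refl = odd-SumOfClasses t 2≤t q

lemma3p4 : (J : ℕ) → 5 ≤ J → (n : ℤ) → ¬ (n ≡ ℤ.pos 0 [mod two^ (J ∸ 1) ]) →
    Σ ℤ λ a → Σ ℤ λ b → Σ ℕ λ i → Σ ℕ λ j →
      (n ≡ a +ℤ b) × (i ≤ J ∸ 3) × (j ≤ J ∸ 3) ×
      (a ≡ two^ i [mod two^ (i + 2) ]) × (b ≡ two^ j [mod two^ (j + 2) ])
lemma3p4 (suc (suc (suc t))) (s≤s (s≤s (s≤s 2≤t))) n n≢0 =
  let a , b , i , j , n≡a+b , i≤t , j≤t , a∈i , b∈j = SumOfClasses-of-∤ t 2≤t n 2^[2+t]∤n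
  in  a , b , i , j , n≡a+b , i≤t , j≤t , Class⇒≡[mod] i a∈i , Class⇒≡[mod] j b∈j
  where
  2^[2+t]∤n : ¬ two^ (2 + t) ∣ n
  2^[2+t]∤n = n≢0 ∘ subst (two^ (2 + t) Unsigned.∣_) (sym (+-identityʳ n)) ∘ ∣⇒∣ᵤ
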